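{- Let $\varphi$ be the bidimensional square morphism of size $3$ over $\{0,1\}$ given, with $\varphi(c)_{(x,y)}$ the letter at column $x$ and row $y$, by $\varphi(0)$: rows $y=0,1,2$ equal $(1,0,0)$, $(1,0,1)$, $(1,0,0)$ respectively; $\varphi(1)$: rows $y=0,1,2$ equal $(1,0,0)$, $(1,0,1)$, $(1,0,1)$ respectively (each row listed as $x=0,1,2$). Then the fixed point $\varphi^\omega(1)$ is SSURDO.
   Context: $\mathbb{N}=\{0,1,\ldots\}$. Iterates: $\varphi^n(c)(\mathbf{i})=\varphi(\varphi^{n-1}(c)(\mathbf{q}'))(\mathbf{r})$ with $\mathbf{i}=3\mathbf{q}'+\mathbf{r}$ componentwise, $\mathbf{r}\in\{0,1,2\}^2$; since $\varphi(1)_{(0,0)}=1$, $\varphi^\omega(1)\colon\mathbb{N}^2\to\{0,1\}$ is the limit of $\varphi^n(1)$. A direction is $\mathbf{q}\in\mathbb{N}^2$ with coprime nonnegative entries. For a word $w$, origin $\mathbf{p}\in\mathbb{N}^2$, size $\mathbf{s}=(s_1,s_2)$ and direction $\mathbf{q}$, let $(w^{(\mathbf{p})})_{\mathbf{q},\mathbf{s}}$ be the one-dimensional word whose $\ell$-th letter is the block $\mathbf{i}\mapsto w(\mathbf{p}+\ell\mathbf{q}+\mathbf{i})$, $\mathbf{i}\in\{0,\ldots,s_1-1\}\times\{0,\ldots,s_2-1\}$. $w$ is SSURDO if for every $\mathbf{s}$ there is $b$ such that for every direction $\mathbf{q}$ and every origin $\mathbf{p}$, every length-$b$ factor of $(w^{(\mathbf{p})})_{\mathbf{q},\mathbf{s}}$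 contains the letter $(w^{(\mathbf{p})})_{\mathbf{q},\mathbf{s}}(0)$. -}

module Defs where

open import Data.Bool using (Bool; true; false)
open import Data.Nat using (ℕ; zero; suc; _+_; _*_; _<_; _≤_)
open import Data.Nat.DivMod using (_/_; _%_)
open import Data.Nat.GCD using (gcd)
open import Data.Product using (_×_; ∃; _,_)
open import Relation.Binary.PropositionalEquality using (_≡_)

-- A bidimensional word over {0,1}: w x y = letter at column x, row y.
-- Letter 0 is false, letter 1 is true.
Word2 : Set
Word2 = ℕ → ℕ → Bool

φ : Bool → ℕ → ℕ → Bool
φ c 0 y = true
φ c 1 y = false
φ c 2 0 = false
φ c 2 1 = true
φ c 2 2 = c
φ c _ _ = false   -- unreachable (positions outside {0,1,2}²)

φ^ : ℕ → Bool → Word2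
φ^ zero c x y = c
φ^ (suc n) c x y = φ (φ^ n c (x / 3) (y / 3)) (x % 3) (y % 3)

-- The fixed point φ^ω(1): the limit of φ^n(1). Since φ(1)_(0,0) = 1 the
-- value at (x,y) is stable once 3^n > max(x,y); n = x + y + 1 suffices.
φω1 : Word2
φω1 x y = φ^ (suc (x + y)) true x y

Direction : ℕ × ℕ → Set
Direction (q₁ , q₂) = gcd q₁ q₂ ≡ 1

-- The ℓ-th letter of (w^(p))_(q,s) equals its 0-th letter.
SameBlock : Word2 → ℕ × ℕ → ℕ × ℕ → ℕ × ℕ → ℕ → Set
SameBlock w (p₁ , p₂) (q₁ , q₂) (s₁ , s₂) ℓ =
  ∀ i j → i < s₁ → j < s₂ →
    w (p₁ + ℓ * q₁ + i) (p₂ + ℓ * q₂ + j) ≡ w (p₁ + i) (p₂ + j)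

SSURDO : Word2 → Set
SSURDO w = ∀ (s : ℕ × ℕ) → ∃ λ (b : ℕ) →
  ∀ (q : ℕ × ℕ) → Direction q → ∀ (p : ℕ × ℕ) → ∀ (k : ℕ) →
    ∃ λ (ℓ : ℕ) → k ≤ ℓ × ℓ < k + b × SameBlock w p q s ℓ

-- φω1 is the fixed point of φ, and the letter φ(c)(r,s) depends on c only at
-- (r,s) = (2,2). Hence translating by 3^N·(c,d) preserves the letter at (x,y)
-- unless the last N base-3 digits of x and y are all 2, and then it reduces to
-- translating the ancestor (x/3^N, y/3^N) by (c,d); in a window of width 3^N
-- there is at most one such ancestor per coordinate. So with 3^N larger than
-- the block size, the block at p recurs at ℓ = 3^N·t along q as soon as the
-- letter at the ancestor P of p recurs at P + t·q. This happens for some t in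
-- every three consecutive values: if q₁ ≢ 0 mod 3 the column digit of P + t·q
-- runs through all residues, and columns 0 and 1 of φ(c) are constant;
-- otherwise that digit is constant, and if it is 2 then, q being coprime, the
-- row digit runs through all residues, and rows 0 and 1 of column 2 are
-- constant.

module Submission where

open import Defs
open import Data.Bool using (Bool; true; false)
open import Data.Empty using (⊥-elim)
open import Data.Fin using (Fin; toℕ)
open import Data.Fin.Patterns using (0F; 1F; 2F)
open import Data.Fin.Properties using (toℕ<n)
open import Data.Nat
open import Data.Nat.DivMod
open import Data.Nat.Divisibility using (_∣_; n∣m*n; ∣n⇒∣m*n; m%n≡0⇒n∣m; ∣1⇒≡1)
open import Data.Nat.GCD using (gcd; gcd-greatest)
open import Data.Nat.Properties
open import Data.Nat.Tactic.RingSolver using (solve-∀)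
open import Data.Product using (_×_; ∃; _,_)
open import Data.Unit using (⊤)
open import Relation.Nullary using (yes; no)
open import Relation.Binary.PropositionalEquality

φ-cong-letter : ∀ {c c′} r s → (r ≡ 2 → s ≡ 2 → c ≡ c′) → φ c r s ≡ φ c′ r s
φ-cong-letter 0 s _ = refl
φ-cong-letter 1 s _ = refl
φ-cong-letter 2 0 _ = refl
φ-cong-letter 2 1 _ = refl
φ-cong-letter 2 2 c≡c′ = cong (λ c → φ c 2 2) (c≡c′ refl refl)
φ-cong-letter 2 (suc (suc (suc _))) _ = refl
φ-cong-letter (suc (suc (suc _))) s _ = refl

φ-off-last-column : ∀ {c c′} r {s s′} → r ≢ 2 → φ c r s ≡ φ c′ r s′
φ-off-last-column 0 _ = refl
φ-off-last-column 1 _ = refl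
φ-off-last-column 2 r≢2 = ⊥-elim (r≢2 refl)
φ-off-last-column (suc (suc (suc _))) _ = refl

column : Bool → ℕ
column true = 0
column false = 1

row : Bool → ℕ
row true = 1
row false = 0

φ-column : ∀ c b s → φ c (column b) s ≡ b
φ-column c true s = refl
φ-column c false s = refl

φ-last-column : ∀ c b → φ c 2 (row b) ≡ b
φ-last-column c true = refl
φ-last-column c false = refl

column<3 : ∀ b → column b < 3
column<3 true = s≤s z≤n
column<3 false = s≤s (s≤s z≤n)

row<3 : ∀ b → row b < 3
row<3 true = s≤s (s≤s z≤n)
row<3 false = s≤s z≤n

φ^-step : ∀ n x y → x ≤ n → y ≤ n → φ^ (suc n) true x y ≡ φ^ n true x y
φ^-step zero .zero .zero z≤n z≤n = refl
φ^-step (suc n) x y x≤ y≤ =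
  cong (λ c → φ c (x % 3) (y % 3)) (φ^-step n (x / 3) (y / 3) (third x≤) (third y≤))
  where
  third : ∀ {z} → z ≤ suc n → z / 3 ≤ n
  third z≤ = ≤-pred (≤-<-trans (/-monoˡ-≤ 3 z≤) (m/n<m (suc n) 3 (s≤s (s≤s z≤n))))

φ^-stable : ∀ {m n} x y → x ≤ m → y ≤ m → m ≤ n → φ^ n true x y ≡ φ^ m true x y
φ^-stable {m} {n} x y x≤ y≤ m≤n =
  trans (cong (λ k → φ^ k true x y) (sym (m∸n+n≡m m≤n))) (stable-after (n ∸ m))
  where
  stable-after : ∀ k → φ^ (k + m) true x y ≡ φ^ m true x y
  stable-after zero = refl
  stable-after (suc k) =
    trans (φ^-step (k + m) x y (≤-trans x≤ (m≤n+m m k)) (≤-trans y≤ (m≤n+m m k))) (stable-after k)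

φω1-fixed : ∀ x y → φω1 x y ≡ φ (φω1 (x / 3) (y / 3)) (x % 3) (y % 3)
φω1-fixed x y = cong (λ c → φ c (x % 3) (y % 3))
  (trans (φ^-stable (x / 3) (y / 3) x/3≤ y/3≤ (+-mono-≤ (m/n≤m x 3) (m/n≤m y 3)))
         (sym (φ^-stable (x / 3) (y / 3) x/3≤ y/3≤ (n≤1+n _))))
  where
  x/3≤ = m≤m+n (x / 3) (y / 3)
  y/3≤ = m≤n+m (y / 3) (x / 3)

φω1-at-digits : ∀ x y {r s} → x % 3 ≡ r → y % 3 ≡ s → φω1 x y ≡ φ (φω1 (x / 3) (y / 3)) r s
φω1-at-digits x y refl refl = φω1-fixed x y

[m+kn]/n≡m/n+k : ∀ m k n .{{_ : NonZero n}} → (m + k * n) / n ≡ m / n + k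
[m+kn]/n≡m/n+k m k n = trans (+-distrib-/-∣ʳ m (n∣m*n k)) (cong (m / n +_) (m*n/n≡m k n))

φω1-shift-step : ∀ x y c d → φω1 (x + c * 3) (y + d * 3) ≡ φ (φω1 (x / 3 + c) (y / 3 + d)) (x % 3) (y % 3)
φω1-shift-step x y c d = trans (φω1-fixed (x + c * 3) (y + d * 3)) (cong₂ φ-at quotients remainders)
  where
  φ-at : ℕ × ℕ → ℕ × ℕ → Bool
  φ-at (u , v) (r , s) = φ (φω1 u v) r s
  quotients : ((x + c * 3) / 3 , (y + d * 3) / 3) ≡ (x / 3 + c , y / 3 + d)
  quotients = cong₂ _,_ ([m+kn]/n≡m/n+k x c 3) ([m+kn]/n≡m/n+k y d 3)
  remainders : ((x + c * 3) % 3 , (y + d * 3) % 3) ≡ (x % 3 , y % 3)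
  remainders = cong₂ _,_ ([m+kn]%n≡m%n x c 3) ([m+kn]%n≡m%n y d 3)

_/3^_ : ℕ → ℕ → ℕ
x /3^ zero = x
x /3^ suc N = (x / 3) /3^ N

EndsInTwos : ℕ → ℕ → Set
EndsInTwos zero x = ⊤
EndsInTwos (suc N) x = x % 3 ≡ 2 × EndsInTwos N (x / 3)

φω1-translate : ∀ N x y c d →
  (EndsInTwos N x → EndsInTwos N y → φω1 (x /3^ N + c) (y /3^ N + d) ≡ φω1 (x /3^ N) (y /3^ N)) →
  φω1 (x + 3 ^ N * c) (y + 3 ^ N * d) ≡ φω1 x y
φω1-translate zero x y c d translated
  rewrite *-identityˡ c | *-identityˡ d = translated _ _
φω1-translate (suc N) x y c d translated = begin
  φω1 (x + 3 ^ suc N * c) (y + 3 ^ suc N * d)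
    ≡⟨ cong₂ φω1 (cong (x +_) (3^[1+N]*≡ c)) (cong (y +_) (3^[1+N]*≡ d)) ⟩
  φω1 (x + 3 ^ N * c * 3) (y + 3 ^ N * d * 3)
    ≡⟨ φω1-shift-step x y (3 ^ N * c) (3 ^ N * d) ⟩
  φ (φω1 (x / 3 + 3 ^ N * c) (y / 3 + 3 ^ N * d)) (x % 3) (y % 3)
    ≡⟨ φ-cong-letter (x % 3) (y % 3) (λ x≡2 y≡2 →
         φω1-translate N (x / 3) (y / 3) c d (λ x′ y′ → translated (x≡2 , x′) (y≡2 , y′))) ⟩
  φ (φω1 (x / 3) (y / 3)) (x % 3) (y % 3)
    ≡⟨ φω1-fixed x y ⟨
  φω1 x y ∎
  where
  open ≡-Reasoning
  3^[1+N]*≡ : ∀ c → 3 ^ suc N * c ≡ 3 ^ N * c * 3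
  3^[1+N]*≡ c = trans (*-assoc 3 (3 ^ N) c) (*-comm 3 (3 ^ N * c))

m<n+3k⇒m/3<n/3+k : ∀ p x M → x % 3 ≡ 2 → x < p + 3 * M → x / 3 < p / 3 + M
m<n+3k⇒m/3<n/3+k p x M x%3≡2 x<p+3M = *-cancelˡ-< 3 (x / 3) (p / 3 + M) (+-cancelˡ-< 2 _ _ (begin-strict
  2 + 3 * (x / 3)           ≡⟨ cong₂ _+_ (sym x%3≡2) (*-comm 3 (x / 3)) ⟩
  x % 3 + x / 3 * 3         ≡⟨ m≡m%n+[m/n]*n x 3 ⟨
  x                         <⟨ x<p+3M ⟩
  p + 3 * M                 ≡⟨ cong (_+ 3 * M) (m≡m%n+[m/n]*n p 3) ⟩
  p % 3 + p / 3 * 3 + 3 * M ≤⟨ +-monoˡ-≤ (3 * M) (+-monoˡ-≤ (p / 3 * 3) (≤-pred (m%n<n p 3))) ⟩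
  2 + p / 3 * 3 + 3 * M     ≡⟨ regroup (p / 3) M ⟩
  2 + 3 * (p / 3 + M)       ∎))
  where
  open ≤-Reasoning
  regroup : ∀ q m → 2 + q * 3 + 3 * m ≡ 2 + 3 * (q + m)
  regroup = solve-∀

EndsInTwos⇒/3^≡ : ∀ N p x → EndsInTwos N x → p ≤ x → x < p + 3 ^ N → x /3^ N ≡ p /3^ N
EndsInTwos⇒/3^≡ zero p x _ p≤x x<p+1 = ≤-antisym (≤-pred (subst (x <_) (+-comm p 1) x<p+1)) p≤x
EndsInTwos⇒/3^≡ (suc N) p x (x%3≡2 , ends) p≤x x<p+3^[1+N] =
  EndsInTwos⇒/3^≡ N (p / 3) (x / 3) ends (/-monoˡ-≤ 3 p≤x) (m<n+3k⇒m/3<n/3+k p x (3 ^ N) x%3≡2 x<p+3^[1+N])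

φω1-translate-window : ∀ N p₁ p₂ c d →
  φω1 (p₁ /3^ N + c) (p₂ /3^ N + d) ≡ φω1 (p₁ /3^ N) (p₂ /3^ N) →
  ∀ i j → i < 3 ^ N → j < 3 ^ N →
  φω1 (p₁ + i + 3 ^ N * c) (p₂ + j + 3 ^ N * d) ≡ φω1 (p₁ + i) (p₂ + j)
φω1-translate-window N p₁ p₂ c d translated i j i<3^N j<3^N =
  φω1-translate N (p₁ + i) (p₂ + j) c d λ ends₁ ends₂ →
    subst₂ (λ u v → φω1 (u + c) (v + d) ≡ φω1 u v)
      (sym (EndsInTwos⇒/3^≡ N p₁ (p₁ + i) ends₁ (m≤m+n p₁ i) (+-monoʳ-< p₁ i<3^N)))
      (sym (EndsInTwos⇒/3^≡ N p₂ (p₂ + j) ends₂ (m≤m+n p₂ j) (+-monoʳ-< p₂ j<3^N)))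
      translated

residue-cycle : ∀ a g r → a < 3 → g < 3 → r < 3 → g ≢ 0 → ∃ λ (u : Fin 3) → (a + toℕ u * g) % 3 ≡ r
residue-cycle 0 1 0 _ _ _ _ = 0F , refl
residue-cycle 0 1 1 _ _ _ _ = 1F , refl
residue-cycle 0 1 2 _ _ _ _ = 2F , refl
residue-cycle 0 2 0 _ _ _ _ = 0F , refl
residue-cycle 0 2 1 _ _ _ _ = 2F , refl
residue-cycle 0 2 2 _ _ _ _ = 1F , refl
residue-cycle 1 1 0 _ _ _ _ = 2F , refl
residue-cycle 1 1 1 _ _ _ _ = 0F , refl
residue-cycle 1 1 2 _ _ _ _ = 1F , refl
residue-cycle 1 2 0 _ _ _ _ = 1F , refl
residue-cycle 1 2 1 _ _ _ _ = 0F , refl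
residue-cycle 1 2 2 _ _ _ _ = 2F , refl
residue-cycle 2 1 0 _ _ _ _ = 1F , refl
residue-cycle 2 1 1 _ _ _ _ = 2F , refl
residue-cycle 2 1 2 _ _ _ _ = 0F , refl
residue-cycle 2 2 0 _ _ _ _ = 2F , refl
residue-cycle 2 2 1 _ _ _ _ = 1F , refl
residue-cycle 2 2 2 _ _ _ _ = 0F , refl
residue-cycle _ 0 _ _ _ _ g≢0 = ⊥-elim (g≢0 refl)
residue-cycle (suc (suc (suc _))) _ _ (s≤s (s≤s (s≤s ()))) _ _ _
residue-cycle _ (suc (suc (suc _))) _ _ (s≤s (s≤s (s≤s ()))) _ _
residue-cycle _ _ (suc (suc (suc _))) _ _ (s≤s (s≤s (s≤s ()))) _

[m+n*o]%d≡[m%d+n*[o%d]]%d : ∀ m n o d .{{_ : NonZero d}} → (m + n * o) % d ≡ (m % d + n * (o % d)) % d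
[m+n*o]%d≡[m%d+n*[o%d]]%d m n o d = begin
  (m + n * o) % d                           ≡⟨ %-distribˡ-+ m (n * o) d ⟩
  (m % d + n * o % d) % d                   ≡⟨ cong (λ k → (m % d + k) % d) n*o≡n*[o%d] ⟩
  (m % d + n * (o % d) % d) % d             ≡⟨ cong (λ k → (k + n * (o % d) % d) % d) (m%n%n≡m%n m d) ⟨
  (m % d % d + n * (o % d) % d) % d         ≡⟨ %-distribˡ-+ (m % d) (n * (o % d)) d ⟨
  (m % d + n * (o % d)) % d                 ∎
  where
  open ≡-Reasoning
  n*o≡n*[o%d] : n * o % d ≡ n * (o % d) % d
  n*o≡n*[o%d] = begin
    n * o % d                 ≡⟨ %-distribˡ-* n o d ⟩
    n % d * (o % d) % d       ≡⟨ cong (λ k → n % d * k % d) (m%n%n≡m%n o d) ⟨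
    n % d * (o % d % d) % d   ≡⟨ %-distribˡ-* n (o % d) d ⟨
    n * (o % d) % d           ∎

[m+n*o]%d≡m%d : ∀ m n o d .{{_ : NonZero d}} → o % d ≡ 0 → (m + n * o) % d ≡ m % d
[m+n*o]%d≡m%d m n o d o%d≡0 = %-remove-+ʳ m (∣n⇒∣m*n n (m%n≡0⇒n∣m o d o%d≡0))

residue-in-window : ∀ a g t₀ r → g % 3 ≢ 0 → r < 3 →
  ∃ λ t → t₀ ≤ t × t < t₀ + 3 × (a + t * g) % 3 ≡ r
residue-in-window a g t₀ r g≢0 r<3
  with u , hits ← residue-cycle ((a + t₀ * g) % 3) (g % 3) r (m%n<n (a + t₀ * g) 3) (m%n<n g 3) r<3 g≢0
  = t₀ + toℕ u , m≤m+n t₀ (toℕ u) , +-monoʳ-< t₀ (toℕ<n u) , (begin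
    (a + (t₀ + toℕ u) * g) % 3                ≡⟨ cong (_% 3) (regroup a t₀ (toℕ u) g) ⟩
    (a + t₀ * g + toℕ u * g) % 3              ≡⟨ [m+n*o]%d≡[m%d+n*[o%d]]%d (a + t₀ * g) (toℕ u) g 3 ⟩
    ((a + t₀ * g) % 3 + toℕ u * (g % 3)) % 3  ≡⟨ hits ⟩
    r                                         ∎)
  where
  open ≡-Reasoning
  regroup : ∀ a t u g → a + (t + u) * g ≡ a + t * g + u * g
  regroup = solve-∀

3∤-gcd : ∀ q₁ q₂ → gcd q₁ q₂ ≡ 1 → q₁ % 3 ≡ 0 → q₂ % 3 ≢ 0
3∤-gcd q₁ q₂ coprime q₁%3≡0 q₂%3≡0
  with () ← ∣1⇒≡1 (subst (3 ∣_) coprime (gcd-greatest (m%n≡0⇒n∣m q₁ 3 q₁%3≡0) (m%n≡0⇒n∣m q₂ 3 q₂%3≡0)))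

φω1-recurs-along : ∀ q₁ q₂ → gcd q₁ q₂ ≡ 1 → ∀ A B t₀ →
  ∃ λ t → t₀ ≤ t × t < t₀ + 3 × φω1 (A + t * q₁) (B + t * q₂) ≡ φω1 A B
φω1-recurs-along q₁ q₂ coprime A B t₀ with q₁ % 3 ≟ 0
... | no q₁%3≢0
  with t , t₀≤t , t<t₀+3 , x-digit ← residue-in-window A q₁ t₀ (column (φω1 A B)) q₁%3≢0 (column<3 _)
  = t , t₀≤t , t<t₀+3 , trans (φω1-at-digits (A + t * q₁) (B + t * q₂) x-digit refl) (φ-column _ (φω1 A B) _)
... | yes q₁%3≡0 with A % 3 ≟ 2
...   | no A%3≢2 = t₀ , ≤-refl , m<m+n t₀ (s≤s z≤n) ,
          trans (φω1-at-digits (A + t₀ * q₁) (B + t₀ * q₂) ([m+n*o]%d≡m%d A t₀ q₁ 3 q₁%3≡0) refl) (trans (φ-off-last-column (A % 3) A%3≢2) (sym (φω1-fixed A B)))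
...   | yes A%3≡2
  with t , t₀≤t , t<t₀+3 , y-digit ← residue-in-window B q₂ t₀ (row (φω1 A B)) (3∤-gcd q₁ q₂ coprime q₁%3≡0) (row<3 _)
  = t , t₀≤t , t<t₀+3 , trans (φω1-at-digits (A + t * q₁) (B + t * q₂) (trans ([m+n*o]%d≡m%d A t q₁ 3 q₁%3≡0) A%3≡2) y-digit) (φ-last-column _ (φω1 A B))

n<[2+m]^n : ∀ m n → n < (2 + m) ^ n
n<[2+m]^n m zero = s≤s z≤n
n<[2+m]^n m (suc n) = subst (_≤ (2 + m) ^ suc n) (+-comm (suc n) 1)
  (+-mono-≤ (n<[2+m]^n m n) (≤-trans (m^n>0 (2 + m) n) (m≤m+n ((2 + m) ^ n) (m * (2 + m) ^ n))))

scaled-window : ∀ M k t w .{{_ : NonZero M}} → suc (k / M) ≤ t → t < suc (k / M) + w →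
  k ≤ M * t × M * t < k + M * suc w
scaled-window M k t w k/M<t t<k/M+1+w = ≤-trans (<⇒≤ k<M*[1+k/M]) (*-monoʳ-≤ M k/M<t) , (begin-strict
  M * t                    <⟨ *-monoʳ-< M t<k/M+1+w ⟩
  M * (suc (k / M) + w)    ≡⟨ cong (M *_) (+-suc (k / M) w) ⟨
  M * (k / M + suc w)      ≡⟨ *-distribˡ-+ M (k / M) (suc w) ⟩
  M * (k / M) + M * suc w  ≤⟨ +-monoˡ-≤ (M * suc w) (subst (_≤ k) (*-comm (k / M) M) (m/n*n≤m k M)) ⟩
  k + M * suc w            ∎)
  where
  open ≤-Reasoning
  k<M*[1+k/M] : k < M * suc (k / M)
  k<M*[1+k/M] = begin-strict
    k                  ≡⟨ m≡m%n+[m/n]*n k M ⟩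
    k % M + k / M * M  <⟨ +-monoˡ-< (k / M * M) (m%n<n k M) ⟩
    M + k / M * M      ≡⟨ cong (M +_) (*-comm (k / M) M) ⟩
    M + M * (k / M)    ≡⟨ *-suc M (k / M) ⟨
    M * suc (k / M)    ∎

proposition6p23 : SSURDO φω1
proposition6p23 (s₁ , s₂) = M * 4 , recurrence
  where
  N = s₁ + s₂
  M = 3 ^ N
  instance
    M≢0 : NonZero M
    M≢0 = m^n≢0 3 N
  s₁<M : s₁ < M
  s₁<M = ≤-<-trans (m≤m+n s₁ s₂) (n<[2+m]^n 1 N)
  s₂<M : s₂ < M
  s₂<M = ≤-<-trans (m≤n+m s₂ s₁) (n<[2+m]^n 1 N)
  regroup : ∀ p m t q i → p + m * t * q + i ≡ p + i + m * (t * q)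
  regroup = solve-∀
  recurrence : ∀ q → Direction q → ∀ p k → ∃ λ ℓ → k ≤ ℓ × ℓ < k + M * 4 × SameBlock φω1 p q (s₁ , s₂) ℓ
  recurrence (q₁ , q₂) coprime (p₁ , p₂) k
    with t , k/M<t , t<k/M+4 , returns ← φω1-recurs-along q₁ q₂ coprime (p₁ /3^ N) (p₂ /3^ N) (suc (k / M))
    with k≤ℓ , ℓ<k+4M ← scaled-window M k t 3 k/M<t t<k/M+4
    = M * t , k≤ℓ , ℓ<k+4M , λ i j i<s₁ j<s₂ →
        trans (cong₂ φω1 (regroup p₁ M t q₁ i) (regroup p₂ M t q₂ j))
              (φω1-translate-window N p₁ p₂ (t * q₁) (t * q₂) returns i j
                 (<-trans i<s₁ s₁<M) (<-trans j<s₂ s₂<M))
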